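{- For every $n\geq1$, $\mathrm{C}_{\sharp=n}\leq_W\mathrm{C}_{\mathbb{N}}$.
   Context: $f\leq_W g$ iff there are computable $H,K:\subseteq\mathbb{N}^{\mathbb{N}}\to\mathbb{N}^{\mathbb{N}}$ such that $p\mapsto K\langle p,G(H(p))\rangle$ realizes $f$ for every realizer $G$ of $g$ (a realizer of $f:\subseteq X\rightrightarrows Y$ being a partial $F$ with $\delta_YF(p)\in f(\delta_X(p))$ for all $p\in\operatorname{dom}(f\circ\delta_X)$). $\mathrm{C}_{\mathbb{N}}$: given a non-empty $A\subseteq\mathbb{N}$ via an enumeration of its complement, output an element of $A$. Closed subsets of Cantor space are represented by binary trees $T\subseteq\{0,1\}^*$ naming the set $[T]$ of infinite paths. $\mathrm{C}_{\sharp=n}$: given a binary tree $T$ which has exactly $n$ vertices on every level $k$ with $2^k\geq n$ and in which, from some finite depth onwards, every vertex has exactly one child, output an element of $[T]$. -}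

module Defs where

open import Data.Nat using (ℕ; zero; suc; _≤_; _^_; _≟_)
open import Data.Fin using (Fin)
open import Data.Vec using (Vec; []; _∷_; lookup)
open import Data.Bool using (Bool; true; false)
open import Data.List using (List; []; _∷_; _++_; _∷ʳ_; length; filter; map; concatMap)
open import Data.Product using (Σ; _×_; _,_)
open import Data.Sum using (_⊎_)
open import Relation.Nullary using (¬_; Dec; does; ¬?)
open import Relation.Binary.PropositionalEquality using (_≡_; _≢_)
open import Level using (Level) renaming (suc to lsuc; zero to lzero)

Baire : Set
Baire = ℕ → ℕ

-- ⟨p , q⟩ (2i) = p i ,  ⟨p , q⟩ (2i+1) = q i
pair : Baire → Baire → Baire
pair p q zero          = p 0
pair p q (suc zero)    = q 0
pair p q (suc (suc n)) = pair (λ i → p (suc i)) (λ i → q (suc i)) n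

-- Oracle (relative) partial recursive functions, in mu-recursive form.
-- A code of arity k denotes a partial function ℕ^k ⇀ ℕ relative to an
-- oracle p : Baire ('orc' queries the oracle).

data Code : ℕ → Set where
  zer  : ∀ {k} → Code k
  succ : Code 1
  proj : ∀ {k} → Fin k → Code k
  orc  : Code 1
  comp : ∀ {k m} → Code m → Vec (Code k) m → Code k
  prec : ∀ {k} → Code k → Code (suc (suc k)) → Code (suc k)
  mu   : ∀ {k} → Code (suc k) → Code k

-- big-step evaluation relation (partial: no derivation = undefined)
data Eval (p : Baire) : ∀ {k} → Code k → Vec ℕ k → ℕ → Set
data EvalAll (p : Baire) : ∀ {k m} → Vec (Code k) m → Vec ℕ k → Vec ℕ m → Set
data MuFrom (p : Baire) : ∀ {k} → Code (suc k) → Vec ℕ k → ℕ → ℕ → Set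

data Eval p where
  e-zer  : ∀ {k} {xs : Vec ℕ k} → Eval p zer xs 0
  e-succ : ∀ {x} → Eval p succ (x ∷ []) (suc x)
  e-proj : ∀ {k} {i : Fin k} {xs} → Eval p (proj i) xs (lookup xs i)
  e-orc  : ∀ {x} → Eval p orc (x ∷ []) (p x)
  e-comp : ∀ {k m} {f : Code m} {gs : Vec (Code k) m} {xs ys y} →
           EvalAll p gs xs ys → Eval p f ys y → Eval p (comp f gs) xs y
  e-prec0 : ∀ {k} {f : Code k} {g} {xs y} →
            Eval p f xs y → Eval p (prec f g) (0 ∷ xs) y
  e-precS : ∀ {k} {f : Code k} {g} {n xs r y} →
            Eval p (prec f g) (n ∷ xs) r → Eval p g (n ∷ r ∷ xs) y →
            Eval p (prec f g) (suc n ∷ xs) y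
  e-mu   : ∀ {k} {f : Code (suc k)} {xs y} →
           MuFrom p f xs 0 y → Eval p (mu f) xs y

data EvalAll p where
  ea-[] : ∀ {k} {xs : Vec ℕ k} → EvalAll p [] xs []
  ea-∷  : ∀ {k m} {g : Code k} {gs : Vec (Code k) m} {xs y ys} →
          Eval p g xs y → EvalAll p gs xs ys → EvalAll p (g ∷ gs) xs (y ∷ ys)

data MuFrom p where
  mu-stop : ∀ {k} {f : Code (suc k)} {xs z} →
            Eval p f (z ∷ xs) 0 → MuFrom p f xs z z
  mu-step : ∀ {k} {f : Code (suc k)} {xs z v y} →
            Eval p f (z ∷ xs) (suc v) → MuFrom p f xs (suc z) y → MuFrom p f xs z y

-- The computable partial map Baire ⇀ Baire given by a code c : Code 1 is
-- p ↦ (i ↦ Φ_c^p(i)), defined on p iff Φ_c^p is total.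
-- 'Computes c p q' says: p is in the domain and the output is q.
Computes : Code 1 → Baire → Baire → Set
Computes c p q = ∀ i → Eval p c (i ∷ []) (q i)

-- Problems (multi-valued functions on represented spaces), presented at
-- the level of names: 'Dom p' = p ∈ dom(f ∘ δ_X), and
-- 'Sol p s' = s ∈ dom δ_Y and δ_Y(s) ∈ f(δ_X(p)).

record Problem : Set₁ where
  field
    Dom : Baire → Set
    Sol : Baire → Baire → Set
open Problem public

record PartialFun : Set₁ where
  field
    dom : Baire → Set
    app : (p : Baire) → dom p → Baire
open PartialFun public

Realizer : Problem → PartialFun → Set
Realizer f G = ∀ p → Dom f p → Σ (dom G p) (λ d → Sol f p (app G p d))

_≤W_ : Problem → Problem → Set₁
f ≤W g = Σ (Code 1) λ H → Σ (Code 1) λ K →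
  (G : PartialFun) → Realizer g G →
  ∀ p → Dom f p →
    Σ Baire λ q → Computes H p q ×
    Σ (dom G q) λ d →
    Σ Baire λ s → Computes K (pair p (app G q d)) s × Sol f p s

-- C_ℕ : a set A ⊆ ℕ is named by p with ℕ ∖ A = { n | ∃ i. p i = n + 1 };
-- a natural number n is named by any r with r 0 = n.

InSet : Baire → ℕ → Set
InSet p n = ∀ i → p i ≢ suc n

C-ℕ : Problem
C-ℕ = record
  { Dom = λ p → Σ ℕ (InSet p)
  ; Sol = λ p r → InSet p (r 0) }

encode : List Bool → ℕ
encode []          = 0
encode (false ∷ w) = suc (2 Data.Nat.* encode w)
encode (true ∷ w)  = suc (suc (2 Data.Nat.* encode w))

InTree : Baire → List Bool → Set
InTree p w = p (encode w) ≢ 0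

inTree? : (p : Baire) (w : List Bool) → Dec (InTree p w)
inTree? p w = ¬? (p (encode w) ≟ 0)

IsTree : Baire → Set
IsTree p = ∀ u v → InTree p (u ++ v) → InTree p u

words : ℕ → List (List Bool)
words zero    = [] ∷ []
words (suc k) = concatMap (λ w → (w ∷ʳ false) ∷ (w ∷ʳ true) ∷ []) (words k)

levelCount : Baire → ℕ → ℕ
levelCount p k = length (filter (inTree? p) (words k))

ExactlyOneChild : Baire → List Bool → Set
ExactlyOneChild p w =
  (InTree p (w ∷ʳ false) × ¬ InTree p (w ∷ʳ true)) ⊎
  (¬ InTree p (w ∷ʳ false) × InTree p (w ∷ʳ true))

prefix : Baire → ℕ → List Bool
prefix s zero    = []
prefix s (suc k) = prefix s k ∷ʳ does (s k ≟ 1)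

IsPath : Baire → Baire → Set
IsPath p s = (∀ i → s i ≤ 1) × (∀ k → InTree p (prefix s k))

C-♯= : ℕ → Problem
C-♯= n = record
  { Dom = λ p → IsTree p
              × (∀ k → n ≤ 2 ^ k → levelCount p k ≡ n)
              × Σ ℕ (λ d → ∀ w → d ≤ length w → InTree p w → ExactlyOneChild p w)
  ; Sol = IsPath }

module Submission where

-- Let T be a tree in the domain of C_{♯=n}, and d a depth from which on every
-- vertex of T has exactly one child.  Read every m ∈ ℕ as the code of a word
-- w_m ∈ {0,1}* and let s_m be the GUIDED PATH of m: it first follows w_m and
-- afterwards continues greedily (left if the left child is in T, else right).
-- If w_m ∈ T and |w_m| ≥ d, then s_m ∈ [T]; and such an m exists, because
-- level d + n of T has n ≥ 1 vertices.
--
-- The reduction: H computes an enumeration of the complement of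
-- A = { m | s_m ∈ [T] } (a countdown sequence visits every m at arbitrarily
-- late stages i, and m is enumerated at stage i when the length-i prefix of
-- s_m has left T); K maps T and an answer m ∈ A of C_ℕ to s_m.

open import Defs
open import Data.Nat using (ℕ; zero; suc; _+_; _*_; pred; _≤_; _<_; z≤n; s≤s; _^_; _≟_; _∸_)
open import Data.Nat.Properties
open import Data.Fin using (zero; suc)
open import Data.Vec using (Vec; []; _∷_)
open import Data.List using (List; []; _∷_; _++_; _∷ʳ_; length; filter; drop)
open import Data.List.Properties using (++-assoc; ++-identityʳ)
open import Data.List.Relation.Unary.All as All using (All; []; _∷_)
open import Data.List.Relation.Unary.All.Properties using (concat⁺; map⁺)
open import Data.List.Membership.Propositional.Properties using (∈-filter⁻)
open import Data.List.Membership.Propositional using (_∈_)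
open import Data.List.Relation.Unary.Any using (here)
open import Data.Bool using (Bool; true; false)
open import Data.Product using (Σ; _×_; _,_)
open import Data.Sum using (inj₁; inj₂)
open import Data.Empty using (⊥-elim)
open import Relation.Nullary using (yes; no; does)
open import Relation.Binary.PropositionalEquality
open import Data.Nat.Solver using (module +-*-Solver)

ifZero : ℕ → ℕ → ℕ → ℕ
ifZero zero    a b = a
ifZero (suc _) a b = b

pow2 : ℕ → ℕ
pow2 zero    = 1
pow2 (suc n) = pow2 n + pow2 n

parity : ℕ → ℕ
parity zero    = 0
parity (suc n) = ifZero (parity n) 1 0

half : ℕ → ℕ
half zero    = 0
half (suc n) = half n + parity n

-- on word codes, removes the first letter: dropBit (encode (c ∷ w)) = encode w
dropBit : ℕ → ℕ
dropBit m = half (pred m)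

dropBits : ℕ → ℕ → ℕ
dropBits zero    m = m
dropBits (suc i) m = dropBit (dropBits i m)

-- 0, 1, 0, 3, 2, 1, 0, 7, 6, … : counts down to 0, then jumps to its index;
-- it takes every value at arbitrarily late stages
countdown : ℕ → ℕ
countdown zero    = 0
countdown (suc n) = ifZero (countdown n) (suc n) (pred (countdown n))

-- The guided path of the word coded by m, relative to a tree name t.
-- pathBit t n r m is its n-th bit when r codes its length-n prefix u: while
-- the word has letters left it copies them, afterwards it is 0 iff u0 ∈ t.
pathBit : (ℕ → ℕ) → ℕ → ℕ → ℕ → ℕ
pathBit t n r m =
  ifZero (dropBits n m) (ifZero (t (r + pow2 n)) 1 0) (parity (pred (dropBits n m)))

pathCode : (ℕ → ℕ) → ℕ → ℕ → ℕ
pathCode t zero    m = 0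
pathCode t (suc n) m = pathCode t n m + suc (pathBit t n (pathCode t n m) m) * pow2 n

guidedPath : (ℕ → ℕ) → ℕ → Baire
guidedPath t m i = pathBit t i (pathCode t i m) m

arg₀ : ∀ {k} → Code (suc k)
arg₀ = proj zero

arg₁ : ∀ {k} → Code (suc (suc k))
arg₁ = proj (suc zero)

arg₂ : ∀ {k} → Code (suc (suc (suc k)))
arg₂ = proj (suc (suc zero))

arg₃ : ∀ {k} → Code (suc (suc (suc (suc k))))
arg₃ = proj (suc (suc (suc zero)))

oneC : ∀ {k} → Code k
oneC = comp succ (zer ∷ [])

addC : Code 2
addC = prec arg₀ (comp succ (arg₁ ∷ []))

mulC : Code 2
mulC = prec zer (comp addC (arg₂ ∷ arg₁ ∷ []))

predC : Code 1
predC = prec zer arg₀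

ifZeroC : Code 3
ifZeroC = prec arg₀ arg₃

pow2C : Code 1
pow2C = prec oneC (comp addC (arg₁ ∷ arg₁ ∷ []))

parityC : Code 1
parityC = prec zer (comp ifZeroC (arg₁ ∷ oneC ∷ zer ∷ []))

halfC : Code 1
halfC = prec zer (comp addC (arg₁ ∷ comp parityC (arg₀ ∷ []) ∷ []))

dropBitC : Code 1
dropBitC = comp halfC (comp predC (arg₀ ∷ []) ∷ [])

dropBitsC : Code 2
dropBitsC = prec arg₀ (comp dropBitC (arg₁ ∷ []))

countdownC : Code 1
countdownC = prec zer (comp ifZeroC (arg₁ ∷ comp succ (arg₀ ∷ []) ∷ comp predC (arg₁ ∷ []) ∷ []))

-- relative to a code tC of the tree name t; arguments (n , r , m)
pathBitC : Code 1 → Code 3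
pathBitC tC = comp ifZeroC (rest ∷ greedy ∷ comp parityC (comp predC (rest ∷ []) ∷ []) ∷ [])
  where
  rest : Code 3
  rest = comp dropBitsC (arg₀ ∷ arg₂ ∷ [])
  greedy : Code 3
  greedy = comp ifZeroC
    (comp tC (comp addC (arg₁ ∷ comp pow2C (arg₀ ∷ []) ∷ []) ∷ []) ∷ oneC ∷ zer ∷ [])

-- arguments (n , m)
pathCodeC : Code 1 → Code 2
pathCodeC tC = prec zer (comp addC (arg₁ ∷
  comp mulC (comp succ (pathBitC tC ∷ []) ∷ comp pow2C (arg₀ ∷ []) ∷ []) ∷ []))

module Evaluation (o : Baire) where

  comp₁ : ∀ {k} {f : Code 1} {g : Code k} {xs a y} →
    Eval o g xs a → Eval o f (a ∷ []) y → Eval o (comp f (g ∷ [])) xs y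
  comp₁ d e = e-comp (ea-∷ d ea-[]) e

  comp₂ : ∀ {k} {f : Code 2} {g h : Code k} {xs a b y} →
    Eval o g xs a → Eval o h xs b → Eval o f (a ∷ b ∷ []) y →
    Eval o (comp f (g ∷ h ∷ [])) xs y
  comp₂ d d′ e = e-comp (ea-∷ d (ea-∷ d′ ea-[])) e

  comp₃ : ∀ {k} {f : Code 3} {g h i : Code k} {xs a b c y} →
    Eval o g xs a → Eval o h xs b → Eval o i xs c → Eval o f (a ∷ b ∷ c ∷ []) y →
    Eval o (comp f (g ∷ h ∷ i ∷ [])) xs y
  comp₃ d d′ d″ e = e-comp (ea-∷ d (ea-∷ d′ (ea-∷ d″ ea-[]))) e

  one-eval : ∀ {k} {xs : Vec ℕ k} → Eval o oneC xs 1
  one-eval = comp₁ e-zer e-succ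

  add-eval : ∀ n x → Eval o addC (n ∷ x ∷ []) (n + x)
  add-eval zero    x = e-prec0 e-proj
  add-eval (suc n) x = e-precS (add-eval n x) (comp₁ e-proj e-succ)

  mul-eval : ∀ n x → Eval o mulC (n ∷ x ∷ []) (n * x)
  mul-eval zero    x = e-prec0 e-zer
  mul-eval (suc n) x = e-precS (mul-eval n x) (comp₂ e-proj e-proj (add-eval x (n * x)))

  pred-eval : ∀ n → Eval o predC (n ∷ []) (pred n)
  pred-eval zero    = e-prec0 e-zer
  pred-eval (suc n) = e-precS (pred-eval n) e-proj

  ifZero-eval : ∀ c a b → Eval o ifZeroC (c ∷ a ∷ b ∷ []) (ifZero c a b)
  ifZero-eval zero    a b = e-prec0 e-proj
  ifZero-eval (suc c) a b = e-precS (ifZero-eval c a b) e-proj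

  pow2-eval : ∀ n → Eval o pow2C (n ∷ []) (pow2 n)
  pow2-eval zero    = e-prec0 one-eval
  pow2-eval (suc n) = e-precS (pow2-eval n) (comp₂ e-proj e-proj (add-eval _ _))

  parity-eval : ∀ n → Eval o parityC (n ∷ []) (parity n)
  parity-eval zero    = e-prec0 e-zer
  parity-eval (suc n) = e-precS (parity-eval n) (comp₃ e-proj one-eval e-zer (ifZero-eval _ _ _))

  half-eval : ∀ n → Eval o halfC (n ∷ []) (half n)
  half-eval zero    = e-prec0 e-zer
  half-eval (suc n) =
    e-precS (half-eval n) (comp₂ e-proj (comp₁ e-proj (parity-eval n)) (add-eval _ _))

  dropBit-eval : ∀ n → Eval o dropBitC (n ∷ []) (dropBit n)
  dropBit-eval n = comp₁ (comp₁ e-proj (pred-eval n)) (half-eval _)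

  dropBits-eval : ∀ n m → Eval o dropBitsC (n ∷ m ∷ []) (dropBits n m)
  dropBits-eval zero    m = e-prec0 e-proj
  dropBits-eval (suc n) m = e-precS (dropBits-eval n m) (comp₁ e-proj (dropBit-eval _))

  countdown-eval : ∀ n → Eval o countdownC (n ∷ []) (countdown n)
  countdown-eval zero    = e-prec0 e-zer
  countdown-eval (suc n) = e-precS (countdown-eval n)
    (comp₃ e-proj (comp₁ e-proj e-succ) (comp₁ e-proj (pred-eval _)) (ifZero-eval _ _ _))

  module GuidedPathEval (tC : Code 1) (t : ℕ → ℕ) (t-eval : ∀ x → Eval o tC (x ∷ []) (t x)) where

    pathBit-eval : ∀ n r m → Eval o (pathBitC tC) (n ∷ r ∷ m ∷ []) (pathBit t n r m)
    pathBit-eval n r m = comp₃ rest-eval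
      (comp₃ (comp₁ (comp₂ e-proj (comp₁ e-proj (pow2-eval n)) (add-eval _ _)) (t-eval _))
             one-eval e-zer (ifZero-eval _ _ _))
      (comp₁ (comp₁ rest-eval (pred-eval _)) (parity-eval _))
      (ifZero-eval _ _ _)
      where
      rest-eval : Eval o (comp dropBitsC (arg₀ ∷ arg₂ ∷ [])) (n ∷ r ∷ m ∷ []) (dropBits n m)
      rest-eval = comp₂ e-proj e-proj (dropBits-eval n m)

    pathCode-eval : ∀ n m → Eval o (pathCodeC tC) (n ∷ m ∷ []) (pathCode t n m)
    pathCode-eval zero    m = e-prec0 e-zer
    pathCode-eval (suc n) m = e-precS (pathCode-eval n m)
      (comp₂ e-proj
        (comp₂ (comp₁ (pathBit-eval n _ m) e-succ) (comp₁ e-proj (pow2-eval n)) (mul-eval _ _))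
        (add-eval _ _))

-- Word codes: encode is bijective base 2 (letter false ↦ digit 1, true ↦ 2)

digit : Bool → ℕ
digit false = 1
digit true  = 2

length-∷ʳ : ∀ {A : Set} (w : List A) b → length (w ∷ʳ b) ≡ suc (length w)
length-∷ʳ []      b = refl
length-∷ʳ (x ∷ w) b = cong suc (length-∷ʳ w b)

double-shift : ∀ e c q → 2 * (e + c * q) ≡ 2 * e + c * (q + q)
double-shift = solve 3 (λ e c q → con 2 :* (e :+ c :* q) := con 2 :* e :+ c :* (q :+ q)) refl
  where open +-*-Solver

encode-∷ʳ : ∀ w b → encode (w ∷ʳ b) ≡ encode w + digit b * pow2 (length w)
encode-∷ʳ []          false = refl
encode-∷ʳ []          true  = refl
encode-∷ʳ (false ∷ w) b     =
  cong suc (trans (cong (2 *_) (encode-∷ʳ w b)) (double-shift (encode w) (digit b) (pow2 (length w))))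
encode-∷ʳ (true ∷ w)  b     =
  cong (λ x → suc (suc x)) (trans (cong (2 *_) (encode-∷ʳ w b)) (double-shift (encode w) (digit b) (pow2 (length w))))

parity-even : ∀ e → parity (e + e) ≡ 0
parity-even zero = refl
parity-even (suc e) rewrite +-suc e e | parity-even e = refl

half-even : ∀ e → half (e + e) ≡ e
half-odd  : ∀ e → half (suc (e + e)) ≡ e
half-even zero    = refl
half-even (suc e) rewrite +-suc e e | half-odd e | parity-even e = +-comm e 1
half-odd e rewrite half-even e | parity-even e = +-identityʳ e

double : ∀ e → 2 * e ≡ e + e
double e = cong (e +_) (+-identityʳ e)

dropBit-encode : ∀ c w → dropBit (encode (c ∷ w)) ≡ encode w
dropBit-encode false w rewrite double (encode w) = half-even (encode w)
dropBit-encode true  w rewrite double (encode w) = half-odd (encode w)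

dropBits-zero : ∀ i → dropBits i 0 ≡ 0
dropBits-zero zero    = refl
dropBits-zero (suc i) rewrite dropBits-zero i = refl

dropBits-suc : ∀ i m → dropBits (suc i) m ≡ dropBits i (dropBit m)
dropBits-suc zero    m = refl
dropBits-suc (suc i) m = cong dropBit (dropBits-suc i m)

dropBits-encode : ∀ i w → dropBits i (encode w) ≡ encode (drop i w)
dropBits-encode zero    w       = refl
dropBits-encode (suc i) []      = dropBits-zero (suc i)
dropBits-encode (suc i) (c ∷ w) = begin
  dropBits (suc i) (encode (c ∷ w)) ≡⟨ dropBits-suc i (encode (c ∷ w)) ⟩
  dropBits i (dropBit (encode (c ∷ w))) ≡⟨ cong (dropBits i) (dropBit-encode c w) ⟩
  dropBits i (encode w) ≡⟨ dropBits-encode i w ⟩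
  encode (drop i w) ∎
  where open ≡-Reasoning

first-letter : ∀ c w g →
  does (ifZero (encode (c ∷ w)) g (parity (pred (encode (c ∷ w)))) ≟ 1) ≡ c
first-letter false w g rewrite double (encode w) | parity-even (encode w) = refl
first-letter true  w g rewrite double (encode w) | parity-even (encode w) = refl

drop-cons : ∀ {A : Set} (w : List A) k → k < length w → Σ A λ c → drop k w ≡ c ∷ drop (suc k) w
drop-cons (x ∷ w) zero    _          = x , refl
drop-cons (x ∷ w) (suc k) (s≤s k<w) = drop-cons w k k<w

drop-beyond : ∀ {A : Set} (w : List A) k → length w ≤ k → drop k w ≡ []
drop-beyond []      zero    _          = refl
drop-beyond []      (suc k) _          = refl
drop-beyond (x ∷ w) (suc k) (s≤s w≤k) = drop-beyond w k w≤k

length-prefix : ∀ s k → length (prefix s k) ≡ k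
length-prefix s zero    = refl
length-prefix s (suc k) = trans (length-∷ʳ (prefix s k) _) (cong suc (length-prefix s k))

prefix-extends : ∀ s k j → Σ (List Bool) λ ys → prefix s (k + j) ≡ prefix s k ++ ys
prefix-extends s k zero    = [] , trans (cong (prefix s) (+-identityʳ k)) (sym (++-identityʳ _))
prefix-extends s k (suc j) with prefix-extends s k j
... | ys , eq = ys ∷ʳ does (s (k + j) ≟ 1) ,
  trans (cong (prefix s) (+-suc k j))
    (trans (cong (_∷ʳ does (s (k + j) ≟ 1)) eq) (++-assoc (prefix s k) ys _))

ifZero-bit : ∀ c → ifZero c 1 0 ≤ 1
ifZero-bit zero    = s≤s z≤n
ifZero-bit (suc c) = z≤n

parity≤1 : ∀ n → parity n ≤ 1
parity≤1 zero    = z≤n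
parity≤1 (suc n) = ifZero-bit (parity n)

pathBit≤1 : ∀ t n r m → pathBit t n r m ≤ 1
pathBit≤1 t n r m with dropBits n m
... | zero  = ifZero-bit (t (r + pow2 n))
... | suc h = parity≤1 h

digit-of-bit : ∀ x → x ≤ 1 → digit (does (x ≟ 1)) ≡ suc x
digit-of-bit zero          _ = refl
digit-of-bit (suc zero)    _ = refl
digit-of-bit (suc (suc x)) (s≤s ())

pathCode-prefix : ∀ t m k → pathCode t k m ≡ encode (prefix (guidedPath t m) k)
pathCode-prefix t m zero    = refl
pathCode-prefix t m (suc k) = begin
  pathCode t k m + suc (s k) * pow2 k
    ≡⟨ cong₂ (λ a b → a + b * pow2 k) (pathCode-prefix t m k) (sym (digit-of-bit (s k) (pathBit≤1 t k _ m))) ⟩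
  encode (prefix s k) + digit (does (s k ≟ 1)) * pow2 k
    ≡⟨ cong (λ l → encode (prefix s k) + digit (does (s k ≟ 1)) * pow2 l) (sym (length-prefix s k)) ⟩
  encode (prefix s k) + digit (does (s k ≟ 1)) * pow2 (length (prefix s k))
    ≡⟨ sym (encode-∷ʳ (prefix s k) _) ⟩
  encode (prefix s (suc k)) ∎
  where
  open ≡-Reasoning
  s : Baire
  s = guidedPath t m

follows-word : ∀ t w k → k ≤ length w → prefix (guidedPath t (encode w)) k ++ drop k w ≡ w
follows-word t w zero    _     = refl
follows-word t w (suc k) k<w with drop-cons w k k<w
... | c , drop≡c∷ = begin
  prefix s (suc k) ++ drop (suc k) w    ≡⟨ ++-assoc (prefix s k) _ (drop (suc k) w) ⟩
  prefix s k ++ (does (s k ≟ 1) ∷ drop (suc k) w) ≡⟨ cong (λ b → prefix s k ++ (b ∷ drop (suc k) w)) copied ⟩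
  prefix s k ++ (c ∷ drop (suc k) w)    ≡⟨ cong (prefix s k ++_) (sym drop≡c∷) ⟩
  prefix s k ++ drop k w                 ≡⟨ follows-word t w k (≤-trans (n≤1+n k) k<w) ⟩
  w ∎
  where
  open ≡-Reasoning
  s : Baire
  s = guidedPath t (encode w)
  copied : does (s k ≟ 1) ≡ c
  copied rewrite dropBits-encode k w | drop≡c∷ = first-letter c (drop (suc k) w) _

greedy-bit : ∀ t w k → length w ≤ k →
  guidedPath t (encode w) k ≡ ifZero (t (encode (prefix (guidedPath t (encode w)) k ∷ʳ false))) 1 0
greedy-bit t w k w≤k = begin
  ifZero (dropBits k m) greedy (parity (pred (dropBits k m)))
    ≡⟨ cong (λ h → ifZero h greedy (parity (pred h))) used-up ⟩
  greedy
    ≡⟨ cong (λ x → ifZero (t x) 1 0) (sym left-child) ⟩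
  ifZero (t (encode (prefix s k ∷ʳ false))) 1 0 ∎
  where
  open ≡-Reasoning
  m : ℕ
  m = encode w
  s : Baire
  s = guidedPath t m
  greedy : ℕ
  greedy = ifZero (t (pathCode t k m + pow2 k)) 1 0
  used-up : dropBits k m ≡ 0
  used-up = trans (dropBits-encode k w) (cong encode (drop-beyond w k w≤k))
  left-child : encode (prefix s k ∷ʳ false) ≡ pathCode t k m + pow2 k
  left-child = trans (encode-∷ʳ (prefix s k) false)
    (cong₂ _+_ (sym (pathCode-prefix t m k)) (trans (+-identityʳ _) (cong pow2 (length-prefix s k))))

prefix-closed : ∀ {p} → IsTree p → ∀ s {k i} → k ≤ i → InTree p (prefix s i) → InTree p (prefix s k)
prefix-closed {p} isT s {k} {i} k≤i inT with prefix-extends s k (i ∸ k)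
... | ys , eq = isT (prefix s k) ys
  (subst (InTree p) eq (subst (λ j → InTree p (prefix s j)) (sym (m+[n∸m]≡n k≤i)) inT))

greedy-child : ∀ p u → ExactlyOneChild p u →
  InTree p (u ∷ʳ does (ifZero (p (encode (u ∷ʳ false))) 1 0 ≟ 1))
greedy-child p u unique with p (encode (u ∷ʳ false)) in left
greedy-child p u (inj₁ (left∈ , _)) | zero  = ⊥-elim (left∈ refl)
greedy-child p u (inj₂ (_ , right∈)) | zero = right∈
greedy-child p u _                   | suc _ = λ left≡0 → 0≢1+n (trans (sym left≡0) left)

guided-path-in-tree : ∀ {p d w} → IsTree p →
  (∀ u → d ≤ length u → InTree p u → ExactlyOneChild p u) →
  d ≤ length w → InTree p w → ∀ k → InTree p (prefix (guidedPath p (encode w)) k)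
guided-path-in-tree {p} {d} {w} isT unique d≤w w∈ = everywhere
  where
  s : Baire
  s = guidedPath p (encode w)

  within : ∀ k → k ≤ length w → InTree p (prefix s k)
  within k k≤w = isT (prefix s k) (drop k w) (subst (InTree p) (sym (follows-word p w k k≤w)) w∈)

  -- below w, every step is the greedy choice from a vertex with one child
  beyond : ∀ j → InTree p (prefix s (length w + j))
  beyond zero    = subst (λ i → InTree p (prefix s i)) (sym (+-identityʳ (length w))) (within (length w) ≤-refl)
  beyond (suc j) = subst (λ i → InTree p (prefix s i)) (sym (+-suc (length w) j))
    (subst (λ b → InTree p (u ∷ʳ does (b ≟ 1))) (sym (greedy-bit p w k (m≤m+n (length w) j)))
      (greedy-child p u (unique u d≤u (beyond j))))
    where
    k : ℕ
    k = length w + j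
    u : List Bool
    u = prefix s k
    d≤u : d ≤ length u
    d≤u = subst (d ≤_) (sym (length-prefix s k)) (≤-trans d≤w (m≤m+n (length w) j))

  everywhere : ∀ k → InTree p (prefix s k)
  everywhere k with k ≤? length w
  ... | yes k≤w = within k k≤w
  ... | no  k≰w = subst (λ i → InTree p (prefix s i)) (m+[n∸m]≡n (≰⇒≥ k≰w)) (beyond (k ∸ length w))

words-length : ∀ k → All (λ w → length w ≡ k) (words k)
words-length zero    = refl ∷ []
words-length (suc k) = concat⁺ (map⁺ (All.map children (words-length k)))
  where
  children : ∀ {w} → length w ≡ k → All (λ v → length v ≡ suc k) ((w ∷ʳ false) ∷ (w ∷ʳ true) ∷ [])
  children {w} w≡k = trans (length-∷ʳ w false) (cong suc w≡k) ∷ trans (length-∷ʳ w true) (cong suc w≡k) ∷ []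

vertex-on-level : ∀ p k → 1 ≤ levelCount p k → Σ (List Bool) λ w → length w ≡ k × InTree p w
vertex-on-level p k count≥1 with filter (inTree? p) (words k) in eq
vertex-on-level p k () | []
... | w ∷ _ with ∈-filter⁻ (inTree? p) {xs = words k} (subst (w ∈_) (sym eq) (here refl))
...   | w∈words , w∈ = w , All.lookup (words-length k) w∈words , w∈

-- guarantees that level d + n is one of the levels with exactly n vertices
n≤2^n : ∀ n → n ≤ 2 ^ n
n≤2^n zero    = z≤n
n≤2^n (suc n) = subst (suc n ≤_) (sym (double (2 ^ n))) (+-mono-≤ (m^n>0 2 n) (n≤2^n n))

-- a tree with n ≥ 1 vertices on every level k with n ≤ 2^k has vertices of
-- every depth d: take level d + n
deep-vertex : ∀ {p n} d → 1 ≤ n → (∀ k → n ≤ 2 ^ k → levelCount p k ≡ n) →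
  Σ (List Bool) λ w → d ≤ length w × InTree p w
deep-vertex {p} {n} d n≥1 levels with vertex-on-level p (d + n) (subst (1 ≤_) (sym count) n≥1)
  where
  count : levelCount p (d + n) ≡ n
  count = levels (d + n) (≤-trans (n≤2^n n) (^-monoʳ-≤ 2 (m≤n+m n d)))
... | w , w≡ , w∈ = w , subst (d ≤_) (sym w≡) (m≤m+n d n) , w∈

∸-suc : ∀ x t → t < x → x ∸ t ≡ suc (x ∸ suc t)
∸-suc (suc x) zero    _         = refl
∸-suc (suc x) (suc t) (s≤s t<x) = ∸-suc x t t<x

countdown-descends : ∀ j x t → countdown j ≡ x → t ≤ x → countdown (j + t) ≡ x ∸ t
countdown-descends j x zero    eq _   = trans (cong countdown (+-identityʳ j)) eq
countdown-descends j x (suc t) eq t<x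
  rewrite +-suc j t | countdown-descends j x t eq (≤-trans (n≤1+n t) t<x) | ∸-suc x t t<x = refl

-- after reaching 0 at stage j₀ ≥ k + m, the countdown restarts at j₀ + 1 and
-- passes m on its way down
countdown-hits : ∀ m k → Σ ℕ λ i → k ≤ i × countdown i ≡ m
countdown-hits m k = top + (top ∸ m) , ≤-trans k≤top (m≤m+n top _) ,
  trans (countdown-descends top top (top ∸ m) restart (m∸n≤m top m)) (m∸[m∸n]≡n m≤top)
  where
  a j₀ top : ℕ
  a = k + m
  j₀ = a + countdown a
  top = suc j₀
  reaches-zero : countdown j₀ ≡ 0
  reaches-zero = trans (countdown-descends a (countdown a) (countdown a) refl ≤-refl) (n∸n≡0 (countdown a))
  restart : countdown top ≡ top
  restart rewrite reaches-zero = refl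
  k≤top : k ≤ top
  k≤top = ≤-trans (m≤m+n k m) (≤-trans (m≤m+n a (countdown a)) (n≤1+n j₀))
  m≤top : m ≤ top
  m≤top = ≤-trans (m≤n+m m k) (≤-trans (m≤m+n a (countdown a)) (n≤1+n j₀))

-- at stage i, with m = countdown i, enumerate m (as m + 1) out of A if the
-- length-i prefix of the guided path of m has left the tree
leavers : Baire → Baire
leavers p i = ifZero (p (pathCode p i (countdown i))) (suc (countdown i)) 0

on-path⇒member : ∀ p m → (∀ k → InTree p (prefix (guidedPath p m) k)) → InSet (leavers p) m
on-path⇒member p m on-path i enumerated with p (pathCode p i (countdown i)) in left
on-path⇒member p m on-path i refl | zero =
  on-path i (trans (cong p (sym (pathCode-prefix p (countdown i) i))) left)
on-path⇒member p m on-path i ()   | suc _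

-- if a prefix of the guided path of m leaves the tree, all later ones do, and
-- one of them is checked at a stage where the countdown equals m
member⇒on-path : ∀ p m → IsTree p → InSet (leavers p) m → ∀ k → InTree p (prefix (guidedPath p m) k)
member⇒on-path p m isT m∈ k k-out with countdown-hits m k
... | i , k≤i , countdown≡m with p (pathCode p i m) ≟ 0
...   | yes i-out = m∈ i enumerated
  where
  enumerated : leavers p i ≡ suc m
  enumerated rewrite countdown≡m | i-out = refl
...   | no  i-in  = prefix-closed {p} isT (guidedPath p m) k≤i
  (subst (λ c → p c ≢ 0) (pathCode-prefix p m i) i-in) k-out

stageC : Code 1
stageC = comp countdownC (arg₀ ∷ [])

enumeratorC : Code 1
enumeratorC = comp ifZeroC
  (comp orc (comp (pathCodeC orc) (arg₀ ∷ stageC ∷ []) ∷ []) ∷ comp succ (stageC ∷ []) ∷ zer ∷ [])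

enumerator-computes : ∀ p → Computes enumeratorC p (leavers p)
enumerator-computes p i = comp₃ (comp₁ (comp₂ e-proj stage (pathCode-eval i (countdown i))) e-orc)
  (comp₁ stage e-succ) e-zer (ifZero-eval _ _ _)
  where
  open Evaluation p
  open GuidedPathEval orc p (λ x → e-orc)
  stage : Eval p stageC (i ∷ []) (countdown i)
  stage = comp₁ e-proj (countdown-eval i)

pair-even : ∀ p q i → pair p q (i + i) ≡ p i
pair-even p q zero    = refl
pair-even p q (suc i) rewrite +-suc i i = pair-even (λ j → p (suc j)) (λ j → q (suc j)) i

-- reads T from the even positions of ⟨T, r⟩
treeC : Code 1
treeC = comp orc (comp addC (arg₀ ∷ arg₀ ∷ []) ∷ [])

-- reads r(0), at position 1 of ⟨T, r⟩
answerC : Code 1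
answerC = comp orc (oneC ∷ [])

pathC : Code 1
pathC = comp (pathBitC treeC) (arg₀ ∷ comp (pathCodeC treeC) (arg₀ ∷ answerC ∷ []) ∷ answerC ∷ [])

path-computes : ∀ p r → Computes pathC (pair p r) (guidedPath p (r 0))
path-computes p r i =
  comp₃ e-proj (comp₂ e-proj answer (pathCode-eval i (r 0))) answer (pathBit-eval i _ _)
  where
  open Evaluation (pair p r)
  tree : ∀ x → Eval (pair p r) treeC (x ∷ []) (p x)
  tree x = subst (Eval (pair p r) treeC (x ∷ [])) (pair-even p r x)
    (comp₁ (comp₂ e-proj e-proj (add-eval x x)) e-orc)
  open GuidedPathEval treeC p tree
  answer : Eval (pair p r) answerC (i ∷ []) (r 0)
  answer = comp₁ one-eval e-orc

proposition23 : (n : ℕ) → 1 ≤ n → C-♯= n ≤W C-ℕ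
proposition23 n n≥1 = enumeratorC , pathC , λ G G-realizes p (isT , levels , d , unique) →
  let w , d≤w , w∈ = deep-vertex {p} d n≥1 levels
      A-nonempty : Σ ℕ (InSet (leavers p))
      A-nonempty = encode w , on-path⇒member p (encode w) (guided-path-in-tree {p} isT unique d≤w w∈)
      answered , answer∈A = G-realizes (leavers p) A-nonempty
      r = app G (leavers p) answered
  in leavers p , enumerator-computes p , answered , guidedPath p (r 0) , path-computes p r ,
     (λ i → pathBit≤1 p i _ (r 0)) , member⇒on-path p (r 0) isT answer∈A
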